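{- Let $G=(V,E)$ be a simple graph, and assume it has a spanning tree $T \subset E$ which has an absorption order in $G$. Then the images of the basis elements in ${\mathbb Z}^E$ corresponding to the edges $E \setminus T$ not lying on $T$ give a set of $\beta(G)$ generators for $K(\operatorname{line} G)$, using the presentation $$K(\operatorname{line} G) \cong {\mathbb Z}^E / \left({\mathbb Z} e_0 + \partial_{\operatorname{line} G}(B_{\operatorname{line} G}) \right),$$ assuming that the orientation chosen for $G$ restricts to a bipartite orientation of $T$ (although $\operatorname{line} G$ may be oriented arbitrarily), and the edge $e_0$ is the designated leaf-edge of $T$ appearing second in the absorption order.
   Context: $\operatorname{line} G$ is the line graph of $G$ (vertex set $E$), $\partial_{\operatorname{line} G}$ its boundary map, $B_{\operatorname{line} G}$ its bond lattice, $K(\cdot)$ the critical group, $\beta(G)$ the number of independent cycles. A spanning tree $T$ has an absorption order in $G$ if $V\sqcup T$ can be linearly ordered so that: (i) it begins with a vertex $v_0$ followed by an edge $e_0$ of $T$ which is the unique edge of $T$ incident to $v_0$; (ii) for every other vertex $v$, there is an edge $e=\{v,w\}$ with $w$ earlier than $v$ and $e$ either in $E\setminus T$ or earlier than $v$; (iii) for every other edge $e\in T$, there is a vertex $v$ incident to $e$ earlier than $e$ such that every other edge incident to $v$ lies in $E\setminus T$ or occurs earlier than $e$. An orientation of $T$ is bipartite if at every vertex the edges of $T$ are all oriented toward it or all away from it. -}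

module Defs where

open import Data.Nat using (ℕ; zero; suc) renaming (_+_ to _+ℕ_)
open import Data.Fin using (Fin; zero; suc; _≟_)
open import Data.Bool using (Bool; true; false; _∧_; _∨_; not; if_then_else_)
open import Data.Integer using (ℤ; +_; _+_; _-_; _*_)
open import Data.List using (List; []; _∷_; _++_)
open import Data.List.Membership.Propositional using (_∈_)
open import Data.List.Relation.Unary.Unique.Propositional using (Unique)
open import Data.Product using (Σ; ∃; ∃-syntax; _×_; _,_)
open import Data.Sum using (_⊎_; inj₁; inj₂)
open import Relation.Binary.PropositionalEquality using (_≡_; _≢_)
open import Relation.Nullary.Decidable using (⌊_⌋)

-- Oriented finite graphs.  Vertices are Fin n, edges are Fin m; edge e
-- goes from (src e) to (tgt e).  The choice of src/tgt is the orientation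
-- of G.

record OGraph : Set where
  field
    n   : ℕ
    m   : ℕ
    src : Fin m → Fin n
    tgt : Fin m → Fin n

module _ (G : OGraph) where
  open OGraph G

  Joins : Fin m → Fin n → Fin n → Set
  Joins e u w = (src e ≡ u × tgt e ≡ w) ⊎ (src e ≡ w × tgt e ≡ u)

  Incident : Fin m → Fin n → Set
  Incident e v = (src e ≡ v) ⊎ (tgt e ≡ v)

  IsSimple : Set
  IsSimple = (∀ e → src e ≢ tgt e)
           × (∀ e f → Joins f (src e) (tgt e) → e ≡ f)

  data Walk (P : Fin m → Set) : Fin n → Fin n → Set where
    nil  : ∀ {v} → Walk P v v
    cons : ∀ {u w v} (e : Fin m) → P e → Joins e u w → Walk P w v → Walk P u v

  walkEdges : ∀ {P u v} → Walk P u v → List (Fin m)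
  walkEdges nil              = []
  walkEdges (cons e _ _ w)   = e ∷ walkEdges w

  InT : (Fin m → Bool) → Fin m → Set
  InT T e = T e ≡ true

  IsSpanningTree : (Fin m → Bool) → Set
  IsSpanningTree T =
      (∀ u v → Walk (InT T) u v)
    × (∀ v (w : Walk (InT T) v v) → Unique (walkEdges w) → walkEdges w ≡ [])

  BipartiteOnT : (Fin m → Bool) → Set
  BipartiteOnT T = ∀ v →
      (∀ e → InT T e → Incident e v → tgt e ≡ v)
    ⊎ (∀ e → InT T e → Incident e v → src e ≡ v)

  Item : Set
  Item = Fin n ⊎ Fin m

  Before : List Item → Item → Item → Set
  Before L x y = ∃[ xs ] ∃[ ys ] ∃[ zs ] (L ≡ xs ++ (x ∷ ys ++ (y ∷ zs)))

  IsAbsorptionOrder : (Fin m → Bool) → List Item → Fin n → Fin m → Set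
  IsAbsorptionOrder T L v₀ e₀ =
      Unique L
    × (∀ v → inj₁ v ∈ L)
    × (∀ e → inj₂ e ∈ L → InT T e)
    × (∀ e → InT T e → inj₂ e ∈ L)
      -- (i)
    × (∃[ rest ] (L ≡ inj₁ v₀ ∷ inj₂ e₀ ∷ rest))
    × InT T e₀ × Incident e₀ v₀
    × (∀ e → InT T e → Incident e v₀ → e ≡ e₀)
      -- (ii)
    × (∀ v → v ≢ v₀ → ∃[ e ] ∃[ w ]
          (Joins e v w × Before L (inj₁ w) (inj₁ v)
           × (T e ≡ false ⊎ Before L (inj₂ e) (inj₁ v))))
      -- (iii)
    × (∀ e → InT T e → e ≢ e₀ → ∃[ v ]
          (Incident e v × Before L (inj₁ v) (inj₂ e)
           × (∀ f → f ≢ e → Incident f v →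
                T f ≡ false ⊎ Before L (inj₂ f) (inj₂ e))))

  _==_ : ∀ {k} → Fin k → Fin k → Bool
  a == b = ⌊ a ≟ b ⌋

  lineAdj : Fin m → Fin m → Bool
  lineAdj e f = not (e == f)
    ∧ ((src e == src f) ∨ (src e == tgt f) ∨ (tgt e == src f) ∨ (tgt e == tgt f))

  sumℤ : ∀ {k} → (Fin k → ℤ) → ℤ
  sumℤ {zero}  f = + 0
  sumℤ {suc k} f = f zero + sumℤ (λ i → f (suc i))

  -- ∂_{line G} ∘ δ_{line G} : ℤ^E → ℤ^E (the Laplacian of line G);
  -- its image is ∂_{line G}(B_{line G}), independently of the orientation
  -- chosen for line G.
  lineLaplacian : (Fin m → ℤ) → Fin m → ℤ
  lineLaplacian x e =
    sumℤ (λ f → if lineAdj e f then x e - x f else + 0)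

  basis : Fin m → Fin m → ℤ
  basis e f = if e == f then + 1 else + 0

  countNotIn : ∀ {k} → (Fin k → Bool) → ℕ
  countNotIn {zero}  T = 0
  countNotIn {suc k} T = (if T zero then 0 else 1) +ℕ countNotIn (λ i → T (suc i))

  -- cycle rank β(G) = |E| - |V| + (number of components); stated here for
  -- connected G (one component), which is the only case used.
  betaConnected : ℤ
  betaConnected = (+ m - + n) + + 1

  -- The images of the basis vectors of the edges in E \ T generate
  --   ℤ^E / (ℤ e₀ + ∂_{line G}(B_{line G})):
  -- every y ∈ ℤ^E is congruent, modulo ℤ e₀ + ∂(B), to an integer
  -- combination of basis vectors of edges not in T.
  GeneratedByNonTreeEdges : (Fin m → Bool) → Fin m → Set
  GeneratedByNonTreeEdges T e₀ =
    ∀ (y : Fin m → ℤ) →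
      Σ (Fin m → ℤ) λ c → Σ ℤ λ a → Σ (Fin m → ℤ) λ x →
        ((∀ e → InT T e → c e ≡ + 0)
        × (∀ f → y f ≡ (sumℤ (λ e → c e * basis e f)
                        + a * basis e₀ f) + lineLaplacian x f))

module Submission where

open import Defs
open import Data.Fin using (Fin)
open import Data.Bool using (Bool)
open import Data.List using (List)
open import Data.Integer using (+_)
open import Data.Product using (_×_)
open import Relation.Binary.PropositionalEquality using (_≡_)

-- Write Λ = ℤe₀ + ∂(B) + ⟨eₑ : e ∉ T⟩ and σᵥ = Σ_{f ∋ v} e_f.  In a simple graph every
-- neighbour of e = {u, w} in line G meets exactly one of u, w, so Δeₑ + σᵤ + σ_w is a
-- multiple of eₑ (Δ = ∂δ the Laplacian of line G).  Walking along the absorption order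
-- one shows σᵥ ∈ Λ for every vertex and eₑ ∈ Λ for every tree edge: σ_{v₀} ∈ Λ because
-- e₀ is the only tree edge at v₀; σᵥ ≡ -σ_w - Δeₑ mod eₑ for the edge e = {v, w} of (ii);
-- and eₑ = σᵥ - Σ (other edges at v) for the vertex v of (iii).
-- For the count, sending each tree edge to its absorbing vertex (e₀ to v₀) is injective
-- and misses an endpoint of the last tree edge of the order, so |T| ≤ |V| - 1, while
-- connectivity gives |T| ≥ |V| - 1.

open import Data.Bool using (true; false; if_then_else_; not; _∧_; _∨_)
open import Data.Empty using (⊥)
open import Data.Fin using (zero; suc; _≟_)
open import Data.Fin.Properties using (suc-injective; 0≢1+n)
open import Data.List using ([]; _∷_; _++_)
open import Data.List.Membership.Propositional using (_∈_; _∉_)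
open import Data.List.Membership.Propositional.Properties using (∈-++⁺ʳ; ∈-++⁻)
open import Data.List.Properties using (∷-injective; ++-assoc)
open import Data.List.Relation.Unary.Any using (here; there)
open import Data.List.Relation.Unary.AllPairs using (_∷_)
open import Data.List.Relation.Unary.Unique.Propositional using (Unique)
open import Data.List.Relation.Unary.Unique.Propositional.Properties using (Unique[x∷xs]⇒x∉xs)
open import Data.Product using (Σ; _,_; ∃; ∃-syntax; proj₁; proj₂)
open import Data.Sum using (_⊎_; inj₁; inj₂; [_,_])
open import Function using (_∘_)
open import Relation.Binary.PropositionalEquality using (_≢_; refl; sym; trans; cong; cong₂; subst; module ≡-Reasoning)
open import Relation.Nullary using (¬_; yes; no; contradiction)
open import Relation.Nullary.Decidable using (isYes)

module _ {a} {A : Set a} where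

  -- Before G L of the definitions, for an arbitrary element type; the two agree definitionally.
  Precedes : List A → A → A → Set a
  Precedes L x y = ∃[ xs ] ∃[ ys ] ∃[ zs ] (L ≡ xs ++ (x ∷ ys ++ (y ∷ zs)))

  Unique-split : ∀ xs xs′ {z : A} {ys ys′} → Unique (xs ++ z ∷ ys) →
                 xs ++ z ∷ ys ≡ xs′ ++ z ∷ ys′ → xs ≡ xs′ × ys ≡ ys′
  Unique-split []       []         u eq = refl , proj₂ (∷-injective eq)
  Unique-split []       (x′ ∷ xs′) u eq with ∷-injective eq
  ... | refl , ys≡ = contradiction (subst (_ ∈_) (sym ys≡) (∈-++⁺ʳ xs′ (here refl))) (Unique[x∷xs]⇒x∉xs u)
  Unique-split (x ∷ xs) []         u eq with ∷-injective eq
  ... | refl , _   = contradiction (∈-++⁺ʳ xs (here refl)) (Unique[x∷xs]⇒x∉xs u)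
  Unique-split (x ∷ xs) (x′ ∷ xs′) (_ ∷ u) eq with ∷-injective eq
  ... | refl , eq′ with Unique-split xs xs′ u eq′
  ... | refl , ys≡ = refl , ys≡

  Unique-++⇒disjoint : ∀ xs {ys} {v : A} → Unique (xs ++ ys) → v ∈ xs → v ∉ ys
  Unique-++⇒disjoint (x ∷ xs) u       (here refl)  v∈ys = Unique[x∷xs]⇒x∉xs u (∈-++⁺ʳ xs v∈ys)
  Unique-++⇒disjoint (x ∷ xs) (_ ∷ u) (there v∈xs)      = Unique-++⇒disjoint xs u v∈xs

  Precedes⇒∈-prefix : ∀ {L} xs {z zs} {w : A} → Unique L → L ≡ xs ++ z ∷ zs →
                      Precedes L w z → w ∈ xs
  Precedes⇒∈-prefix xs {z} {zs} {w} u refl (as , bs , cs , eq)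
    with Unique-split xs (as ++ w ∷ bs) u (trans eq (sym (++-assoc as (w ∷ bs) (z ∷ cs))))
  ... | refl , _ = ∈-++⁺ʳ as (here refl)

  Precedes⇒∈-suffix : ∀ {L} xs {z zs} {w : A} → Unique L → L ≡ xs ++ z ∷ zs →
                      Precedes L z w → w ∈ zs
  Precedes⇒∈-suffix xs u refl (as , bs , cs , eq) with Unique-split xs as u eq
  ... | _ , refl = ∈-++⁺ʳ bs (here refl)

  Precedes-asym : ∀ {L} {x y : A} → Unique L → Precedes L x y → ¬ Precedes L y x
  Precedes-asym u (xs , ys , zs , eq) y≺x =
    Unique-++⇒disjoint xs (subst Unique eq u) (Precedes⇒∈-prefix xs u eq y≺x)
      (there (∈-++⁺ʳ ys (here refl)))

  Precedes-induction : ∀ {p} (P : A → Set p) {L} → Unique L →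
    (∀ z → z ∈ L → (∀ w → Precedes L w z → P w) → P z) → ∀ z → z ∈ L → P z
  Precedes-induction P {L} u step = go [] L refl λ _ ()
    where
    go : ∀ xs ys → L ≡ xs ++ ys → (∀ w → w ∈ xs → P w) → ∀ z → z ∈ ys → P z
    go xs (y ∷ ys) L≡ ih z z∈ with step y (subst (y ∈_) (sym L≡) (∈-++⁺ʳ xs (here refl)))
                                          (λ w w≺y → ih w (Precedes⇒∈-prefix xs u L≡ w≺y))
    ... | Py with z∈
    ... | here refl  = Py
    ... | there z∈ys = go (xs ++ y ∷ []) ys (trans L≡ (sym (++-assoc xs (y ∷ []) ys))) ih′ z z∈ys
      where
      ih′ : ∀ w → w ∈ xs ++ y ∷ [] → P w
      ih′ w w∈ with ∈-++⁻ xs w∈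
      ... | inj₁ w∈xs        = ih w w∈xs
      ... | inj₂ (here refl) = Py

split-at-last-inj₂ : ∀ {a b} {A : Set a} {B : Set b} (L : List (A ⊎ B)) →
  (∀ y → inj₂ y ∉ L) ⊎ ∃[ xs ] ∃[ y ] ∃[ ys ] (L ≡ xs ++ inj₂ y ∷ ys × ∀ y′ → inj₂ y′ ∉ ys)
split-at-last-inj₂ [] = inj₁ λ _ ()
split-at-last-inj₂ (z ∷ L) with split-at-last-inj₂ L
... | inj₂ (xs , y , ys , refl , none) = inj₂ (z ∷ xs , y , ys , refl , none)
split-at-last-inj₂ (inj₁ x ∷ L) | inj₁ none = inj₁ λ { y (there y∈) → none y y∈ }
split-at-last-inj₂ (inj₂ y ∷ L) | inj₁ none = inj₂ ([] , y , L , refl , none)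

module Counting where
  open import Data.Nat using (ℕ; zero; suc; _+_; _≤_; _<_; z≤n; s≤s; s≤s⁻¹)
  open import Data.Nat.Properties using (≤-trans; m≤n⇒m≤1+n; n≤1+n; m≤n+m)
  open import Data.Bool.Properties using (∧-conicalˡ; ∧-zeroʳ; ∨-zeroʳ; ∨-identityʳ)

  count : ∀ {k} → (Fin k → Bool) → ℕ
  count {zero}  P = 0
  count {suc k} P = (if P zero then 1 else 0) + count (P ∘ suc)

  _⊆_ : ∀ {k} → (Fin k → Bool) → (Fin k → Bool) → Set
  P ⊆ Q = ∀ i → P i ≡ true → Q i ≡ true

  count-all : ∀ k → count {k} (λ _ → true) ≡ k
  count-all zero    = refl
  count-all (suc k) = cong suc (count-all k)

  count-none : ∀ k → count {k} (λ _ → false) ≡ 0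
  count-none zero    = refl
  count-none (suc k) = count-none k

  count-tail : ∀ {k} (P : Fin (suc k) → Bool) → count (P ∘ suc) ≤ count P
  count-tail P = m≤n+m _ (if P zero then 1 else 0)

  count-mono : ∀ {k} {P Q : Fin k → Bool} → P ⊆ Q → count P ≤ count Q
  count-mono {zero}          P⊆Q = z≤n
  count-mono {suc k} {P} {Q} P⊆Q with P zero in P₀ | Q zero in Q₀
  ... | true  | true  = s≤s (count-mono (P⊆Q ∘ suc))
  ... | false | true  = m≤n⇒m≤1+n (count-mono (P⊆Q ∘ suc))
  ... | false | false = count-mono (P⊆Q ∘ suc)
  ... | true  | false = contradiction (trans (sym (P⊆Q zero P₀)) Q₀) λ ()

  count-mono-< : ∀ {k} {P Q : Fin k → Bool} j → P ⊆ Q → P j ≡ false → Q j ≡ true → count P < count Q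
  count-mono-< {suc k} {P} {Q} zero    P⊆Q Pj Qj rewrite Pj | Qj = s≤s (count-mono (P⊆Q ∘ suc))
  count-mono-< {suc k} {P} {Q} (suc j) P⊆Q Pj Qj with P zero in P₀ | Q zero in Q₀
  ... | true  | true  = s≤s (count-mono-< j (P⊆Q ∘ suc) Pj Qj)
  ... | false | true  = m≤n⇒m≤1+n (count-mono-< j (P⊆Q ∘ suc) Pj Qj)
  ... | false | false = count-mono-< j (P⊆Q ∘ suc) Pj Qj
  ... | true  | false = contradiction (trans (sym (P⊆Q zero P₀)) Q₀) λ ()

  count-≤-suc : ∀ {k} {P Q : Fin k → Bool} j → (∀ i → i ≢ j → P i ≡ true → Q i ≡ true) →
                count P ≤ suc (count Q)
  count-≤-suc {suc k} {P} {Q} zero    P⊆Q with P zero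
  ... | true  = s≤s (≤-trans (count-mono λ i → P⊆Q (suc i) λ ()) (count-tail Q))
  ... | false = ≤-trans (count-mono λ i → P⊆Q (suc i) λ ()) (≤-trans (count-tail Q) (n≤1+n _))
  count-≤-suc {suc k} {P} {Q} (suc j) P⊆Q with P zero in P₀ | Q zero in Q₀
  ... | true  | true  = s≤s (count-≤-suc j λ i i≢j → P⊆Q (suc i) (i≢j ∘ suc-injective))
  ... | false | true  = ≤-trans (count-≤-suc j λ i i≢j → P⊆Q (suc i) (i≢j ∘ suc-injective)) (n≤1+n _)
  ... | false | false = count-≤-suc j λ i i≢j → P⊆Q (suc i) (i≢j ∘ suc-injective)
  ... | true  | false = contradiction (trans (sym (P⊆Q zero (λ ()) P₀)) Q₀) λ ()

  count<⇒∃false : ∀ {k} (P : Fin k → Bool) → count P < k → ∃ λ i → P i ≡ false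
  count<⇒∃false {suc k} P cP<k with P zero in P₀
  ... | false = zero , P₀
  ... | true with count<⇒∃false (P ∘ suc) (s≤s⁻¹ cP<k)
  ... | i , Pi = suc i , Pi

  count-injection : ∀ {a b} {P : Fin a → Bool} {Q : Fin b → Bool}
    (g : ∀ i → P i ≡ true → Fin b) → (∀ i p → Q (g i p) ≡ true) →
    (∀ i j p q → g i p ≡ g j q → i ≡ j) → count P ≤ count Q
  count-injection {zero}              g g∈Q g-inj = z≤n
  count-injection {suc a} {P = P} {Q} g g∈Q g-inj with P zero in P₀
  ... | false = count-injection (g ∘ suc) (g∈Q ∘ suc) λ i j p q eq → suc-injective (g-inj (suc i) (suc j) p q eq)
  ... | true  = ≤-trans (s≤s (count-injection (g ∘ suc) g∘suc∈Q′ g∘suc-inj)) (count-mono-< g₀ Q′⊆Q Q′g₀ (g∈Q zero P₀))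
    where
    g₀ = g zero P₀
    Q′ : Fin _ → Bool
    Q′ j = Q j ∧ not (isYes (j ≟ g₀))
    Q′⊆Q : Q′ ⊆ Q
    Q′⊆Q j = ∧-conicalˡ (Q j) _
    Q′g₀ : Q′ g₀ ≡ false
    Q′g₀ with g₀ ≟ g₀
    ... | yes _   = ∧-zeroʳ (Q g₀)
    ... | no g₀≢g₀ = contradiction refl g₀≢g₀
    g∘suc∈Q′ : ∀ i p → Q′ (g (suc i) p) ≡ true
    g∘suc∈Q′ i p with g (suc i) p ≟ g₀
    ... | yes eq = contradiction (sym (g-inj (suc i) zero p P₀ eq)) 0≢1+n
    ... | no _ rewrite g∈Q (suc i) p = refl
    g∘suc-inj : ∀ i j p q → g (suc i) p ≡ g (suc j) q → i ≡ j
    g∘suc-inj i j p q eq = suc-injective (g-inj (suc i) (suc j) p q eq)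

  insert : ∀ {k} → (Fin k → Bool) → Fin k → Fin k → Bool
  insert P j i = P i ∨ isYes (i ≟ j)

  ⊆-insert : ∀ {k} (P : Fin k → Bool) j → P ⊆ insert P j
  ⊆-insert P j i Pi rewrite Pi = refl

  insert-∋ : ∀ {k} (P : Fin k → Bool) j → insert P j j ≡ true
  insert-∋ P j with j ≟ j
  ... | yes _   = ∨-zeroʳ (P j)
  ... | no j≢j = contradiction refl j≢j

  count-insert : ∀ {k} (P : Fin k → Bool) j → count (insert P j) ≤ suc (count P)
  count-insert P j = count-≤-suc j insert-⊆
    where
    insert-⊆ : ∀ i → i ≢ j → insert P j i ≡ true → P i ≡ true
    insert-⊆ i i≢j Pi with i ≟ j
    ... | yes i≡j = contradiction i≡j i≢j
    ... | no _    = trans (sym (∨-identityʳ (P i))) Pi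

open Counting

module LineLaplacian (G : OGraph) where
  open OGraph G
  open import Data.Nat using (zero; suc)
  open import Data.Integer using (ℤ; _+_; _-_; _*_; -_)
  open import Data.Integer.Properties
    using (+-*-semiring; +-*-ring; +-identityˡ; +-identityʳ; *-zeroʳ; *-identityʳ; neg-involutive; +-inverseˡ; +-comm)
  open import Data.Integer.Tactic.RingSolver using (solve-∀)
  open import Algebra.Properties.Semiring.Sum +-*-semiring using (sum; sum-cong-≗; ∑-distrib-+; *-distribˡ-sum)
  open import Algebra.Properties.Ring +-*-ring using (x[y-z]≈xy-xz)
  open import Algebra.Bundles using (CommutativeMonoid)
  import Data.Bool.Properties as Bool
  open import Algebra.Properties.CommutativeSemigroup
    (CommutativeMonoid.commutativeSemigroup Bool.∨-commutativeMonoid) using (interchange)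
  open import Relation.Nullary.Decidable using (⌊_⌋)
  open ≡-Reasoning

  sumℤ≡sum : ∀ {k} (h : Fin k → ℤ) → sumℤ G h ≡ sum h
  sumℤ≡sum {zero}  h = refl
  sumℤ≡sum {suc k} h = cong (_+_ (h zero)) (sumℤ≡sum (h ∘ suc))

  sumℤ-cong : ∀ {k} {h h′ : Fin k → ℤ} → (∀ i → h i ≡ h′ i) → sumℤ G h ≡ sumℤ G h′
  sumℤ-cong {h = h} {h′} h≗h′ = begin
    sumℤ G h  ≡⟨ sumℤ≡sum h ⟩
    sum h     ≡⟨ sum-cong-≗ h≗h′ ⟩
    sum h′    ≡⟨ sumℤ≡sum h′ ⟨
    sumℤ G h′ ∎

  sumℤ-distrib-+ : ∀ {k} (h h′ : Fin k → ℤ) → sumℤ G (λ i → h i + h′ i) ≡ sumℤ G h + sumℤ G h′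
  sumℤ-distrib-+ h h′ = begin
    sumℤ G (λ i → h i + h′ i) ≡⟨ sumℤ≡sum (λ i → h i + h′ i) ⟩
    sum (λ i → h i + h′ i)    ≡⟨ ∑-distrib-+ h h′ ⟩
    sum h + sum h′            ≡⟨ cong₂ _+_ (sumℤ≡sum h) (sumℤ≡sum h′) ⟨
    sumℤ G h + sumℤ G h′      ∎

  sumℤ-*ˡ : ∀ {k} (c : ℤ) (h : Fin k → ℤ) → sumℤ G (λ i → c * h i) ≡ c * sumℤ G h
  sumℤ-*ˡ c h = begin
    sumℤ G (λ i → c * h i) ≡⟨ sumℤ≡sum (λ i → c * h i) ⟩
    sum (λ i → c * h i)    ≡⟨ *-distribˡ-sum c h ⟨
    c * sum h              ≡⟨ cong (c *_) (sumℤ≡sum h) ⟨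
    c * sumℤ G h           ∎

  sumℤ-zero : ∀ {k} {h : Fin k → ℤ} → (∀ i → h i ≡ + 0) → sumℤ G h ≡ + 0
  sumℤ-zero {zero}  h≡0 = refl
  sumℤ-zero {suc k} h≡0 = cong₂ _+_ (h≡0 zero) (sumℤ-zero (h≡0 ∘ suc))

  sumℤ-single : ∀ {k} {h : Fin k → ℤ} j → (∀ i → i ≢ j → h i ≡ + 0) → sumℤ G h ≡ h j
  sumℤ-single {suc k} {h} zero    h≡0 =
    trans (cong (_+_ (h zero)) (sumℤ-zero λ i → h≡0 (suc i) λ ())) (+-identityʳ (h zero))
  sumℤ-single {suc k} {h} (suc j) h≡0 =
    trans (cong₂ _+_ (h≡0 zero λ ()) (sumℤ-single j λ i i≢j → h≡0 (suc i) (i≢j ∘ suc-injective)))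
          (+-identityˡ (h (suc j)))

  basis-diag : ∀ e → basis G e e ≡ + 1
  basis-diag e with e ≟ e
  ... | yes _   = refl
  ... | no e≢e = contradiction refl e≢e

  basis-off : ∀ {e f} → e ≢ f → basis G e f ≡ + 0
  basis-off {e} {f} e≢f with e ≟ f
  ... | yes e≡f = contradiction e≡f e≢f
  ... | no _    = refl

  sumℤ-basis : ∀ (c : Fin m → ℤ) f → sumℤ G (λ e → c e * basis G e f) ≡ c f
  sumℤ-basis c f = begin
    sumℤ G (λ e → c e * basis G e f) ≡⟨ sumℤ-single f (λ e e≢f → trans (cong (c e *_) (basis-off e≢f)) (*-zeroʳ (c e))) ⟩
    c f * basis G f f                ≡⟨ cong (c f *_) (basis-diag f) ⟩
    c f * + 1                        ≡⟨ *-identityʳ (c f) ⟩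
    c f                              ∎

  lineLaplacian-+ : ∀ (x x′ : Fin m → ℤ) f →
    lineLaplacian G (λ i → x i + x′ i) f ≡ lineLaplacian G x f + lineLaplacian G x′ f
  lineLaplacian-+ x x′ f = trans (sumℤ-cong termwise) (sumℤ-distrib-+ {m} _ _)
    where
    termwise : ∀ g → (if lineAdj G f g then (x f + x′ f) - (x g + x′ g) else + 0)
                   ≡ (if lineAdj G f g then x f - x g else + 0) + (if lineAdj G f g then x′ f - x′ g else + 0)
    termwise g with lineAdj G f g
    ... | true  = interchange-- (x f) (x′ f) (x g) (x′ g)
      where
      interchange-- : ∀ a b c d → (a + b) - (c + d) ≡ (a - c) + (b - d)
      interchange-- = solve-∀
    ... | false = refl

  lineLaplacian-*ˡ : ∀ (c : ℤ) (x : Fin m → ℤ) f →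
    lineLaplacian G (λ i → c * x i) f ≡ c * lineLaplacian G x f
  lineLaplacian-*ˡ c x f = trans (sumℤ-cong termwise) (sumℤ-*ˡ {m} c _)
    where
    termwise : ∀ g → (if lineAdj G f g then c * x f - c * x g else + 0)
                   ≡ c * (if lineAdj G f g then x f - x g else + 0)
    termwise g with lineAdj G f g
    ... | true  = sym (x[y-z]≈xy-xz c (x f) (x g))
    ... | false = sym (*-zeroʳ c)

  lineLaplacian-zero : ∀ f → lineLaplacian G (λ _ → + 0) f ≡ + 0
  lineLaplacian-zero f = sumℤ-zero termwise
    where
    termwise : ∀ g → (if lineAdj G f g then + 0 - + 0 else + 0) ≡ + 0
    termwise g with lineAdj G f g
    ... | true  = refl
    ... | false = refl

  indicator : Bool → ℤ
  indicator b = if b then + 1 else + 0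

  indicator-∨ : ∀ a b → (a ≡ true → b ≡ true → ⊥) → indicator (a ∨ b) ≡ indicator a + indicator b
  indicator-∨ true  true  both = contradiction refl (both refl)
  indicator-∨ true  false _    = refl
  indicator-∨ false true  _    = refl
  indicator-∨ false false _    = refl

  lineLaplacian-basis-off : ∀ {e f} → f ≢ e → lineLaplacian G (basis G e) f ≡ - indicator (lineAdj G f e)
  lineLaplacian-basis-off {e} {f} f≢e = trans (sumℤ-single e term-off) term-e
    where
    e≢f = f≢e ∘ sym
    term-off : ∀ g → g ≢ e → (if lineAdj G f g then basis G e f - basis G e g else + 0) ≡ + 0
    term-off g g≢e rewrite basis-off e≢f | basis-off (g≢e ∘ sym) with lineAdj G f g
    ... | true  = refl
    ... | false = refl
    term-e : (if lineAdj G f e then basis G e f - basis G e e else + 0) ≡ - indicator (lineAdj G f e)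
    term-e rewrite basis-off e≢f | basis-diag e with lineAdj G f e
    ... | true  = refl
    ... | false = refl

  star : Fin n → Fin m → ℤ
  star v f = indicator (⌊ src f ≟ v ⌋ ∨ ⌊ tgt f ≟ v ⌋)

  star-cases : ∀ v f → (Incident G f v × star v f ≡ + 1) ⊎ (¬ Incident G f v × star v f ≡ + 0)
  star-cases v f with src f ≟ v | tgt f ≟ v
  ... | yes s≡v | _       = inj₁ (inj₁ s≡v , refl)
  ... | no _    | yes t≡v = inj₁ (inj₂ t≡v , refl)
  ... | no s≢v  | no t≢v  = inj₂ ([ s≢v , t≢v ] , refl)

  ∨-true⇒Incident : ∀ {f v} → ⌊ src f ≟ v ⌋ ∨ ⌊ tgt f ≟ v ⌋ ≡ true → Incident G f v
  ∨-true⇒Incident {f} {v} _ with src f ≟ v | tgt f ≟ v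
  ∨-true⇒Incident         _ | yes s≡v | _       = inj₁ s≡v
  ∨-true⇒Incident         _ | no _    | yes t≡v = inj₂ t≡v

  lineAdj-off : ∀ {e f} → f ≢ e → lineAdj G f e ≡
    (⌊ src f ≟ src e ⌋ ∨ ⌊ tgt f ≟ src e ⌋) ∨ (⌊ src f ≟ tgt e ⌋ ∨ ⌊ tgt f ≟ tgt e ⌋)
  lineAdj-off {e} {f} f≢e with f ≟ e
  ... | yes f≡e = contradiction f≡e f≢e
  ... | no _    = sym (trans (interchange a b c d) (Bool.∨-assoc a c (b ∨ d)))
    where
    a = ⌊ src f ≟ src e ⌋
    b = ⌊ tgt f ≟ src e ⌋
    c = ⌊ src f ≟ tgt e ⌋
    d = ⌊ tgt f ≟ tgt e ⌋

  Incident-both⇒≡ : IsSimple G → ∀ {e f} → Incident G f (src e) → Incident G f (tgt e) → f ≡ e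
  Incident-both⇒≡ (loopless , _)   {e} (inj₁ s≡s) (inj₁ s≡t) = contradiction (trans (sym s≡s) s≡t) (loopless e)
  Incident-both⇒≡ (_ , unparallel) {e} (inj₁ s≡s) (inj₂ t≡t) = sym (unparallel e _ (inj₁ (s≡s , t≡t)))
  Incident-both⇒≡ (_ , unparallel) {e} (inj₂ t≡s) (inj₁ s≡t) = sym (unparallel e _ (inj₂ (s≡t , t≡s)))
  Incident-both⇒≡ (loopless , _)   {e} (inj₂ t≡s) (inj₂ t≡t) = contradiction (trans (sym t≡s) t≡t) (loopless e)

  star-endpoints : IsSimple G → ∀ {e f} → f ≢ e →
    star (src e) f + star (tgt e) f ≡ - lineLaplacian G (basis G e) f
  star-endpoints simple {e} {f} f≢e = begin
    indicator A + indicator B        ≡⟨ indicator-∨ A B meets-one ⟨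
    indicator (A ∨ B)                ≡⟨ cong indicator (lineAdj-off f≢e) ⟨
    indicator (lineAdj G f e)        ≡⟨ neg-involutive _ ⟨
    - - indicator (lineAdj G f e)    ≡⟨ cong -_ (lineLaplacian-basis-off f≢e) ⟨
    - lineLaplacian G (basis G e) f  ∎
    where
    A = ⌊ src f ≟ src e ⌋ ∨ ⌊ tgt f ≟ src e ⌋
    B = ⌊ src f ≟ tgt e ⌋ ∨ ⌊ tgt f ≟ tgt e ⌋
    meets-one : A ≡ true → B ≡ true → ⊥
    meets-one a b = f≢e (Incident-both⇒≡ simple (∨-true⇒Incident a) (∨-true⇒Incident b))

  star-joins : IsSimple G → ∀ {e u w f} → Joins G e u w → f ≢ e →
    (star u f + star w f) + lineLaplacian G (basis G e) f ≡ + 0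
  star-joins simple {e} {f = f} (inj₁ (refl , refl)) f≢e rewrite star-endpoints simple f≢e =
    +-inverseˡ (lineLaplacian G (basis G e) f)
  star-joins simple {e} {f = f} (inj₂ (refl , refl)) f≢e
    rewrite +-comm (star (tgt e) f) (star (src e) f) | star-endpoints simple f≢e =
    +-inverseˡ (lineLaplacian G (basis G e) f)

module Span (G : OGraph) (T : Fin (OGraph.m G) → Bool) (e₀ : Fin (OGraph.m G)) where
  open OGraph G
  open LineLaplacian G
  open import Data.Nat using (zero; suc)
  open import Data.Integer using (ℤ; _+_; _-_; _*_; -_)
  open import Data.Integer.Properties using (+-*-ring; +-identityˡ; *-zeroʳ)
  open import Data.Integer.Tactic.RingSolver using (solve-∀)
  open import Algebra.Properties.Ring +-*-ring using (-1*x≈-x)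

  -- y ∈ Λ; GeneratedByNonTreeEdges G T e₀ unfolds to ∀ y → Spanned y.
  Spanned : (Fin m → ℤ) → Set
  Spanned y = Σ (Fin m → ℤ) λ c → Σ ℤ λ a → Σ (Fin m → ℤ) λ x →
        ((∀ e → InT G T e → c e ≡ + 0)
        × (∀ f → y f ≡ (sumℤ G (λ e → c e * basis G e f) + a * basis G e₀ f) + lineLaplacian G x f))

  combination : (Fin m → ℤ) → ℤ → (Fin m → ℤ) → Fin m → ℤ
  combination c a x f = (c f + a * basis G e₀ f) + lineLaplacian G x f

  Spanned-intro : ∀ {y} c a x → (∀ e → InT G T e → c e ≡ + 0) →
                  (∀ f → y f ≡ combination c a x f) → Spanned y
  Spanned-intro c a x c∉T y≗ = c , a , x , c∉T , λ f →
    trans (y≗ f) (cong (λ s → (s + a * basis G e₀ f) + lineLaplacian G x f) (sym (sumℤ-basis c f)))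

  Spanned-elim : ∀ {y} → ((c , a , x , _) : Spanned y) → ∀ f → y f ≡ combination c a x f
  Spanned-elim (c , a , x , _ , y≗) f =
    trans (y≗ f) (cong (λ s → (s + a * basis G e₀ f) + lineLaplacian G x f) (sumℤ-basis c f))

  combination-+ : ∀ c c′ a a′ x x′ f →
    combination (λ e → c e + c′ e) (a + a′) (λ e → x e + x′ e) f ≡ combination c a x f + combination c′ a′ x′ f
  combination-+ c c′ a a′ x x′ f rewrite lineLaplacian-+ x x′ f =
    regroup (c f) (c′ f) a a′ (basis G e₀ f) (lineLaplacian G x f) (lineLaplacian G x′ f)
    where
    regroup : ∀ s s′ a a′ b l l′ → ((s + s′) + (a + a′) * b) + (l + l′) ≡ ((s + a * b) + l) + ((s′ + a′ * b) + l′)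
    regroup = solve-∀

  combination-*ˡ : ∀ k c a x f →
    combination (λ e → k * c e) (k * a) (λ e → k * x e) f ≡ k * combination c a x f
  combination-*ˡ k c a x f rewrite lineLaplacian-*ˡ k x f =
    factor k (c f) a (basis G e₀ f) (lineLaplacian G x f)
    where
    factor : ∀ k s a b l → (k * s + (k * a) * b) + k * l ≡ k * ((s + a * b) + l)
    factor = solve-∀

  Spanned-resp : ∀ {y y′} → (∀ f → y f ≡ y′ f) → Spanned y → Spanned y′
  Spanned-resp y≗y′ (c , a , x , c∉T , y≗) = c , a , x , c∉T , λ f → trans (sym (y≗y′ f)) (y≗ f)

  Spanned-+ : ∀ {y y′} → Spanned y → Spanned y′ → Spanned (λ f → y f + y′ f)
  Spanned-+ s@(c , a , x , c∉T , _) s′@(c′ , a′ , x′ , c′∉T , _) =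
    Spanned-intro (λ e → c e + c′ e) (a + a′) (λ e → x e + x′ e)
      (λ e e∈T → cong₂ _+_ (c∉T e e∈T) (c′∉T e e∈T))
      (λ f → trans (cong₂ _+_ (Spanned-elim s f) (Spanned-elim s′ f)) (sym (combination-+ c c′ a a′ x x′ f)))

  Spanned-*ˡ : ∀ k {y} → Spanned y → Spanned (λ f → k * y f)
  Spanned-*ˡ k s@(c , a , x , c∉T , _) =
    Spanned-intro (λ e → k * c e) (k * a) (λ e → k * x e)
      (λ e e∈T → trans (cong (k *_) (c∉T e e∈T)) (*-zeroʳ k))
      (λ f → trans (cong (k *_) (Spanned-elim s f)) (sym (combination-*ˡ k c a x f)))

  Spanned-- : ∀ {y y′} → Spanned y → Spanned y′ → Spanned (λ f → y f - y′ f)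
  Spanned-- {y} {y′} s s′ =
    Spanned-resp (λ f → cong (_+_ (y f)) (-1*x≈-x (y′ f))) (Spanned-+ s (Spanned-*ˡ (- + 1) s′))

  Spanned-lineLaplacian : ∀ x → Spanned (lineLaplacian G x)
  Spanned-lineLaplacian x =
    Spanned-intro (λ _ → + 0) (+ 0) x (λ _ _ → refl) (λ f → sym (+-identityˡ (lineLaplacian G x f)))

  Spanned-zero : Spanned (λ _ → + 0)
  Spanned-zero = Spanned-resp lineLaplacian-zero (Spanned-lineLaplacian (λ _ → + 0))

  Spanned-e₀ : Spanned (basis G e₀)
  Spanned-e₀ = Spanned-intro (λ _ → + 0) (+ 1) (λ _ → + 0) (λ _ _ → refl) coordinates
    where
    coordinates : ∀ f → basis G e₀ f ≡ combination (λ _ → + 0) (+ 1) (λ _ → + 0) f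
    coordinates f rewrite lineLaplacian-zero f = unit (basis G e₀ f)
      where
      unit : ∀ b → b ≡ (+ 0 + + 1 * b) + + 0
      unit = solve-∀

  Spanned-nonTree : ∀ e → T e ≡ false → Spanned (basis G e)
  Spanned-nonTree e e∉T = Spanned-intro (basis G e) (+ 0) (λ _ → + 0) c∉T coordinates
    where
    c∉T : ∀ e′ → InT G T e′ → basis G e e′ ≡ + 0
    c∉T e′ e′∈T = basis-off λ { refl → contradiction (trans (sym e∉T) e′∈T) λ () }
    coordinates : ∀ f → basis G e f ≡ combination (basis G e) (+ 0) (λ _ → + 0) f
    coordinates f rewrite lineLaplacian-zero f = unit (basis G e f) (basis G e₀ f)
      where
      unit : ∀ b b₀ → b ≡ (b + + 0 * b₀) + + 0
      unit = solve-∀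

  Spanned-sum : ∀ {k} (h : Fin k → Fin m → ℤ) → (∀ i → Spanned (h i)) → Spanned (λ f → sumℤ G (λ i → h i f))
  Spanned-sum {zero}  h _  = Spanned-zero
  Spanned-sum {suc k} h sh = Spanned-+ (sh zero) (Spanned-sum (h ∘ suc) (sh ∘ suc))

  Spanned-supported : ∀ y → (∀ f → y f ≡ + 0 ⊎ Spanned (basis G f)) → Spanned y
  Spanned-supported y supp = Spanned-resp (sumℤ-basis y) (Spanned-sum (λ e f → y e * basis G e f) term)
    where
    term : ∀ e → Spanned (λ f → y e * basis G e f)
    term e with supp e
    ... | inj₁ yₑ≡0 = Spanned-resp (λ f → cong (_* basis G e f) (sym yₑ≡0)) Spanned-zero
    ... | inj₂ sₑ   = Spanned-*ˡ (y e) sₑ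

  module AbsorptionSteps (simple : IsSimple G) where

    Spanned-star-via-edge : ∀ {e v w} → Joins G e v w → Spanned (basis G e) → Spanned (star w) → Spanned (star v)
    Spanned-star-via-edge {e} {v} {w} joins sₑ s_w =
      Spanned-resp recover (Spanned-- (Spanned-- (Spanned-supported d supported) s_w) (Spanned-lineLaplacian (basis G e)))
      where
      d : Fin m → ℤ
      d f = (star v f + star w f) + lineLaplacian G (basis G e) f
      supported : ∀ f → d f ≡ + 0 ⊎ Spanned (basis G f)
      supported f with f ≟ e
      ... | yes refl = inj₂ sₑ
      ... | no f≢e   = inj₁ (star-joins simple joins f≢e)
      recover : ∀ f → (d f - star w f) - lineLaplacian G (basis G e) f ≡ star v f
      recover f = cancel (star v f) (star w f) (lineLaplacian G (basis G e) f)
        where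
        cancel : ∀ s t l → ((s + t) + l - t) - l ≡ s
        cancel = solve-∀

    Spanned-basis-via-vertex : ∀ {e v} → Incident G e v → Spanned (star v) →
      (∀ f → f ≢ e → Incident G f v → Spanned (basis G f)) → Spanned (basis G e)
    Spanned-basis-via-vertex {e} {v} e∋v s_v s-others =
      Spanned-resp recover (Spanned-- s_v (Spanned-supported d supported))
      where
      d : Fin m → ℤ
      d f = star v f - basis G e f
      supported : ∀ f → d f ≡ + 0 ⊎ Spanned (basis G f)
      supported f with f ≟ e | star-cases v f
      ... | yes refl | inj₁ (_ , star≡1) rewrite star≡1 | basis-diag f = inj₁ refl
      ... | yes refl | inj₂ (e∌v , _)    = contradiction e∋v e∌v
      ... | no f≢e   | inj₁ (f∋v , _)    = inj₂ (s-others f f≢e f∋v)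
      ... | no f≢e   | inj₂ (_ , star≡0) rewrite star≡0 | basis-off (f≢e ∘ sym) = inj₁ refl
      recover : ∀ f → star v f - d f ≡ basis G e f
      recover f = cancel (star v f) (basis G e f)
        where
        cancel : ∀ s b → s - (s - b) ≡ b
        cancel = solve-∀

    Spanned-star-of-leaf : ∀ {v} → (∀ f → InT G T f → Incident G f v → f ≡ e₀) → Spanned (star v)
    Spanned-star-of-leaf {v} leaf = Spanned-supported (star v) supported
      where
      supported : ∀ f → star v f ≡ + 0 ⊎ Spanned (basis G f)
      supported f with star-cases v f | T f in f∈T
      ... | inj₂ (_ , star≡0) | _     = inj₁ star≡0
      ... | inj₁ _            | false = inj₂ (Spanned-nonTree f f∈T)
      ... | inj₁ (f∋v , _)    | true  rewrite leaf f f∈T f∋v = inj₂ Spanned-e₀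

    Absorbed : Item G → Set
    Absorbed (inj₁ v) = Spanned (star v)
    Absorbed (inj₂ e) = Spanned (basis G e)

    items-absorbed : ∀ {L v₀} → IsAbsorptionOrder G T L v₀ e₀ → ∀ z → z ∈ L → Absorbed z
    items-absorbed {L} {v₀} (unique , _ , L⊆T , _ , _ , _ , _ , leaf , vertex-rule , edge-rule) =
      Precedes-induction Absorbed unique step
      where
      nonTree-or-earlier : ∀ {e z} → (∀ w → Precedes L w z → Absorbed w) →
                           T e ≡ false ⊎ Before G L (inj₂ e) z → Spanned (basis G e)
      nonTree-or-earlier {e} ih = [ Spanned-nonTree e , ih (inj₂ e) ]
      step : ∀ z → z ∈ L → (∀ w → Precedes L w z → Absorbed w) → Absorbed z
      step (inj₁ v) _ ih with v ≟ v₀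
      ... | yes refl = Spanned-star-of-leaf leaf
      ... | no v≢v₀ with vertex-rule v v≢v₀
      ... | e , w , joins , w≺v , e-ok =
        Spanned-star-via-edge joins (nonTree-or-earlier ih e-ok) (ih (inj₁ w) w≺v)
      step (inj₂ e) e∈L ih with e ≟ e₀
      ... | yes refl = Spanned-e₀
      ... | no e≢e₀ with edge-rule e (L⊆T e e∈L) e≢e₀
      ... | v , e∋v , v≺e , others =
        Spanned-basis-via-vertex e∋v (ih (inj₁ v) v≺e) λ f f≢e f∋v → nonTree-or-earlier ih (others f f≢e f∋v)

    absorption-generates : ∀ {L v₀} → IsAbsorptionOrder G T L v₀ e₀ → GeneratedByNonTreeEdges G T e₀
    absorption-generates absorption@(_ , _ , _ , T⊆L , _) y = Spanned-supported y λ f → inj₂ (Spanned-basis f)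
      where
      Spanned-basis : ∀ f → Spanned (basis G f)
      Spanned-basis f with T f in f∈T
      ... | false = Spanned-nonTree f f∈T
      ... | true  = items-absorbed absorption (inj₂ f) (T⊆L f f∈T)

module TreeSize (G : OGraph) where
  open OGraph G
  open import Data.Nat using (zero; suc; _+_; _≤_; _<_; _≤?_; s≤s)
  open import Data.Nat.Properties
    using (≤-trans; ≤-reflexive; m≤m+n; m≤n+m; +-monoˡ-≤; +-monoʳ-≤; +-mono-≤; ≰⇒>; +-suc; +-identityʳ; module ≤-Reasoning)
  open import Data.Bool.Properties using (∧-zeroʳ; ∧-conicalˡ)
  import Data.Bool
  open import Axiom.UniquenessOfIdentityProofs using (module Decidable⇒UIP)
  open Decidable⇒UIP Data.Bool._≟_ using (≡-irrelevant)

  crossing-edge : ∀ {P : Fin m → Set} {u r} (S : Fin n → Bool) → S u ≡ false → S r ≡ true → Walk G P u r →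
    ∃[ e ] ∃[ a ] ∃[ b ] (P e × Joins G e a b × S a ≡ false × S b ≡ true)
  crossing-edge S Su≡f Sr≡t nil = contradiction (trans (sym Su≡f) Sr≡t) λ ()
  crossing-edge {u = u} S Su≡f Sr≡t (cons {w = w} e Pe joins rest) with S w in Sw
  ... | true  = e , u , w , Pe , joins , Su≡f , Sw
  ... | false = crossing-edge S Sw Sr≡t rest

  other-endpoint : (∀ e → src e ≢ tgt e) → ∀ e v → ∃[ x ] (Incident G e x × x ≢ v)
  other-endpoint loopless e v with src e ≟ v
  ... | yes refl = tgt e , inj₂ refl , loopless e ∘ sym
  ... | no s≢v   = src e , inj₁ refl , s≢v

  module _ (T : Fin m → Bool) where

    outside : (Fin n → Bool) → Fin m → Bool
    outside S e = T e ∧ not (S (src e) ∧ S (tgt e))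

    outside-antitone : ∀ S S′ → S ⊆ S′ → outside S′ ⊆ outside S
    outside-antitone S S′ S⊆S′ e out with T e | S (src e) in Ss | S (tgt e) in St
    ... | false | _     | _     = out
    ... | true  | false | _     = refl
    ... | true  | true  | false = refl
    ... | true  | true  | true  rewrite S⊆S′ _ Ss | S⊆S′ _ St = out

    outside-∋ : ∀ S {e a b} → InT G T e → Joins G e a b → S a ≡ false → outside S e ≡ true
    outside-∋ S     e∈T (inj₁ (refl , _)) Sa≡f rewrite e∈T | Sa≡f = refl
    outside-∋ S {e} e∈T (inj₂ (_ , refl)) Sa≡f rewrite e∈T | Sa≡f | ∧-zeroʳ (S (src e)) = refl

    outside-∌ : ∀ S {e} → S (src e) ≡ true → S (tgt e) ≡ true → outside S e ≡ false
    outside-∌ S {e} Ss St rewrite Ss | St = ∧-zeroʳ (T e)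

    insert-joins : ∀ S {e a b} → Joins G e a b → S b ≡ true →
                   insert S a (src e) ≡ true × insert S a (tgt e) ≡ true
    insert-joins S (inj₁ (refl , refl)) Sb = insert-∋ S _ , ⊆-insert S _ _ Sb
    insert-joins S (inj₂ (refl , refl)) Sb = ⊆-insert S _ _ Sb , insert-∋ S _

    module _ {r : Fin n} (connected : ∀ u → Walk G (InT G T) u r) where

      -- Adding to S the outer endpoint of a tree edge that enters S raises |S| by one and
      -- removes that edge from outside S.
      n≤count+count-outside : ∀ k S → S r ≡ true → n ≤ count S + k → n ≤ count S + count (outside S)
      n≤count+count-outside k S Sr bound with n ≤? count S
      ... | yes n≤S = ≤-trans n≤S (m≤m+n _ _)
      n≤count+count-outside zero    S Sr bound | no n≰S = contradiction (subst (n ≤_) (+-identityʳ _) bound) n≰S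
      n≤count+count-outside (suc k) S Sr bound | no n≰S with count<⇒∃false S (≰⇒> n≰S)
      ... | v , Sv with crossing-edge S Sv Sr (connected v)
      ... | e , a , b , e∈T , joins , Sa , Sb = begin
        n                                    ≤⟨ n≤count+count-outside k S′ (⊆-insert S a r Sr) bound′ ⟩
        count S′ + count (outside S′)        ≤⟨ +-monoˡ-≤ _ (count-insert S a) ⟩
        suc (count S) + count (outside S′)   ≡⟨ +-suc _ _ ⟨
        count S + suc (count (outside S′))   ≤⟨ +-monoʳ-≤ (count S) (count-mono-< e (outside-antitone S S′ (⊆-insert S a)) e∉out′ e∈out) ⟩
        count S + count (outside S)          ∎
        where
        open ≤-Reasoning
        S′ = insert S a
        bound′ : n ≤ count S′ + k
        bound′ = ≤-trans bound (≤-trans (≤-reflexive (+-suc (count S) k))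
                   (+-monoˡ-≤ k (count-mono-< a (⊆-insert S a) Sa (insert-∋ S a))))
        e∈out : outside S e ≡ true
        e∈out = outside-∋ S e∈T joins Sa
        e∉out′ : outside S′ e ≡ false
        e∉out′ = let (s∈S′ , t∈S′) = insert-joins S joins Sb in outside-∌ S′ s∈S′ t∈S′

      connected⇒n≤1+|T| : n ≤ suc (count T)
      connected⇒n≤1+|T| = begin
        n                              ≤⟨ n≤count+count-outside n S₀ (insert-∋ _ r) (m≤n+m n (count S₀)) ⟩
        count S₀ + count (outside S₀)  ≤⟨ +-mono-≤ count-S₀ (count-mono λ e → ∧-conicalˡ (T e) _) ⟩
        1 + count T                    ∎
        where
        open ≤-Reasoning
        S₀ = insert (λ _ → false) r
        count-S₀ : count S₀ ≤ 1
        count-S₀ = subst (count S₀ ≤_) (cong suc (count-none n)) (count-insert _ r)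

    module AbsorbingVertex
      (L : List (Item G)) (v₀ : Fin n) (e₀ : Fin m)
      (unique : Unique L)
      (e₀∋v₀ : Incident G e₀ v₀)
      (leaf : ∀ e → InT G T e → Incident G e v₀ → e ≡ e₀)
      (edge-rule : ∀ e → InT G T e → e ≢ e₀ → ∃[ v ]
          (Incident G e v × Before G L (inj₁ v) (inj₂ e)
           × (∀ f → f ≢ e → Incident G f v → T f ≡ false ⊎ Before G L (inj₂ f) (inj₂ e))))
      where

      absorber : ∀ e → InT G T e → Fin n
      absorber e e∈T with e ≟ e₀
      ... | yes _   = v₀
      ... | no e≢e₀ = proj₁ (edge-rule e e∈T e≢e₀)

      absorber-incident : ∀ e e∈T → Incident G e (absorber e e∈T)
      absorber-incident e e∈T with e ≟ e₀
      ... | yes refl = e₀∋v₀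
      ... | no e≢e₀  = proj₁ (proj₂ (edge-rule e e∈T e≢e₀))

      absorber-last : ∀ e e∈T f → InT G T f → f ≢ e → Incident G f (absorber e e∈T) →
                      Before G L (inj₂ f) (inj₂ e)
      absorber-last e e∈T f f∈T f≢e f∋a with e ≟ e₀
      ... | yes refl = contradiction (leaf f f∈T f∋a) f≢e
      ... | no e≢e₀ with proj₂ (proj₂ (proj₂ (edge-rule e e∈T e≢e₀))) f f≢e f∋a
      ...   | inj₁ f∉T = contradiction (trans (sym f∈T) f∉T) λ ()
      ...   | inj₂ f≺e = f≺e

      absorber-injective : ∀ e e′ e∈T e′∈T → absorber e e∈T ≡ absorber e′ e′∈T → e ≡ e′
      absorber-injective e e′ e∈T e′∈T same with e ≟ e′
      ... | yes e≡e′ = e≡e′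
      ... | no e≢e′  = contradiction
          (absorber-last e e∈T e′ e′∈T (e≢e′ ∘ sym) (subst (Incident G e′) (sym same) (absorber-incident e′ e′∈T)))
          (Precedes-asym unique
            (absorber-last e′ e′∈T e e∈T e≢e′ (subst (Incident G e) same (absorber-incident e e∈T))))

      absorber-misses : (∀ e → src e ≢ tgt e) → (∀ e → inj₂ e ∈ L → InT G T e) → inj₂ e₀ ∈ L →
                        ∃[ x ] (∀ e e∈T → absorber e e∈T ≢ x)
      absorber-misses loopless L⊆T e₀∈L with split-at-last-inj₂ L
      ... | inj₁ no-edges = contradiction e₀∈L (no-edges e₀)
      ... | inj₂ (xs , eₗ , ys , L≡ , none-after) = x , misses
        where
        eₗ∈T = L⊆T eₗ (subst (inj₂ eₗ ∈_) (sym L≡) (∈-++⁺ʳ xs (here refl)))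
        endpoint = other-endpoint loopless eₗ (absorber eₗ eₗ∈T)
        x = proj₁ endpoint
        misses : ∀ e e∈T → absorber e e∈T ≢ x
        misses e e∈T a≡x with e ≟ eₗ
        ... | yes refl = proj₂ (proj₂ endpoint) (trans (sym a≡x) (cong (absorber e) (≡-irrelevant e∈T eₗ∈T)))
        ... | no e≢eₗ  = none-after e (Precedes⇒∈-suffix xs unique L≡
            (absorber-last e e∈T eₗ eₗ∈T (e≢eₗ ∘ sym) (subst (Incident G eₗ) (sym a≡x) (proj₁ (proj₂ endpoint)))))

      1+|T|≤n : (∀ e → src e ≢ tgt e) → (∀ e → inj₂ e ∈ L → InT G T e) → inj₂ e₀ ∈ L → suc (count T) ≤ n
      1+|T|≤n loopless L⊆T e₀∈L with absorber-misses loopless L⊆T e₀∈L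
      ... | x , misses =
        ≤-trans (s≤s (count-injection absorber avoids-x absorber-injective))
                (subst (count not-x <_) (count-all n) (count-mono-< x (λ _ _ → refl) not-x-x refl))
        where
        not-x : Fin n → Bool
        not-x v = not (isYes (v ≟ x))
        not-x-x : not-x x ≡ false
        not-x-x with x ≟ x
        ... | yes _   = refl
        ... | no x≢x = contradiction refl x≢x
        avoids-x : ∀ e e∈T → not-x (absorber e e∈T) ≡ true
        avoids-x e e∈T with absorber e e∈T ≟ x
        ... | yes a≡x = contradiction a≡x (misses e e∈T)
        ... | no _    = refl

module CycleRank (G : OGraph) where
  open OGraph G
  open import Data.Nat as ℕ using (zero; suc)
  open import Data.Nat.Properties using (+-suc)
  open import Data.Integer using (_+_; _-_)
  open import Data.Integer.Properties using (pos-+)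
  open import Data.Integer.Tactic.RingSolver using (solve-∀)

  countNotIn+count : ∀ {k} (P : Fin k → Bool) → countNotIn G P ℕ.+ count P ≡ k
  countNotIn+count {zero}  P = refl
  countNotIn+count {suc k} P with P zero
  ... | true  = trans (+-suc _ _) (cong suc (countNotIn+count (P ∘ suc)))
  ... | false = cong suc (countNotIn+count (P ∘ suc))

  countNotIn≡betaConnected : ∀ T → suc (count T) ≡ n → + countNotIn G T ≡ betaConnected G
  countNotIn≡betaConnected T 1+|T|≡n = begin
    + a                                 ≡⟨ cancel (+ a) (+ b) ⟩
    ((+ a + + b) - (+ 1 + + b)) + + 1   ≡⟨ cong (λ x → (x - + suc b) + + 1) (pos-+ a b) ⟨
    (+ (a ℕ.+ b) - + suc b) + + 1       ≡⟨ cong₂ (λ x y → (+ x - + y) + + 1) (countNotIn+count T) 1+|T|≡n ⟩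
    (+ m - + n) + + 1                   ∎
    where
    open ≡-Reasoning
    a = countNotIn G T
    b = count T
    cancel : ∀ a b → a ≡ ((a + b) - (+ 1 + b)) + + 1
    cancel = solve-∀

proposition4p2 :
    (G : OGraph) → IsSimple G →
    (T : Fin (OGraph.m G) → Bool) → IsSpanningTree G T →
    BipartiteOnT G T →
    (L : List (Item G)) (v₀ : Fin (OGraph.n G)) (e₀ : Fin (OGraph.m G)) →
    IsAbsorptionOrder G T L v₀ e₀ →
    GeneratedByNonTreeEdges G T e₀ × (+ countNotIn G T ≡ betaConnected G)
proposition4p2 G simple@(loopless , _) T (connected , _) _ L v₀ e₀
  absorption@(unique , _ , L⊆T , T⊆L , _ , e₀∈T , e₀∋v₀ , leaf , _ , edge-rule) =
  absorption-generates absorption , countNotIn≡betaConnected T 1+|T|≡n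
  where
  open Span.AbsorptionSteps G T e₀ simple
  open TreeSize G
  open AbsorbingVertex T L v₀ e₀ unique e₀∋v₀ leaf edge-rule
  open CycleRank G
  open import Data.Nat using (suc)
  open import Data.Nat.Properties using (≤-antisym)
  1+|T|≡n : suc (count T) ≡ OGraph.n G
  1+|T|≡n = ≤-antisym (1+|T|≤n loopless L⊆T (T⊆L e₀ e₀∈T)) (connected⇒n≤1+|T| T (λ u → connected u v₀))
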